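{- Let $\ell\geq 2$ be an integer. If a graph $G$ with at least $2\ell-2$ vertices has a slick tree-decomposition with width at most $\ell-2$, then $G$ has a slick tree-decomposition with width at most $4\ell-7$ and order at most $\frac{|V(G)|}{\ell-1}$.
   Context: Graphs are simple, undirected and finite. A tree-decomposition of $G$ is a collection $(B_x:x\in V(T))$, $T$ a non-empty tree, of subsets of $V(G)$ such that each edge of $G$ has both ends in some $B_x$ and for each $v\in V(G)$ the set $\{x:v\in B_x\}$ induces a non-empty connected subtree of $T$; its width is $\max_x|B_x|-1$ and its order is $|V(T)|$. It is rooted if $T$ is rooted. A rooted tree-decomposition is slick if for each edge $xy\in E(T)$ with $x$ the parent of $y$, and each vertex $v\in B_x\cap B_y$, we have $(N_G(v)\cap B_y)\setminus B_x\neq\emptyset$. -}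

module Defs where

open import Data.Nat using (ℕ; zero; suc; _≤_; _<_)
open import Data.Fin using (Fin; toℕ) renaming (zero to fzero; suc to fsuc)
open import Data.Fin.Subset using (Subset; _∈_; _∉_; ∣_∣)
open import Data.Bool using (Bool; true; false)
open import Data.Product using (Σ; ∃; _×_; _,_)
open import Data.Sum using (_⊎_)
open import Relation.Binary.PropositionalEquality using (_≡_)

record Graph (n : ℕ) : Set where
  field
    adj    : Fin n → Fin n → Bool
    sym    : ∀ u v → adj u v ≡ adj v u
    irrefl : ∀ v → adj v v ≡ false

open Graph public

Adj : ∀ {n} → Graph n → Fin n → Fin n → Set
Adj G u v = adj G u v ≡ true

-- A rooted tree with node set Fin (suc k): node fzero is the root, and the
-- parent of node (fsuc j) is  par j , which has a smaller index.
-- (Every finite non-empty rooted tree is isomorphic to one of this form,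
-- e.g. by numbering nodes in BFS order.)
record RootedTree (k : ℕ) : Set where
  field
    par    : Fin k → Fin (suc k)
    par-lt : ∀ j → toℕ (par j) < toℕ (fsuc j)

open RootedTree public

IsParent : ∀ {k} → RootedTree k → Fin (suc k) → Fin (suc k) → Set
IsParent {k} T x y = Σ (Fin k) λ j → (y ≡ fsuc j) × (par T j ≡ x)

TAdj : ∀ {k} → RootedTree k → Fin (suc k) → Fin (suc k) → Set
TAdj T x y = IsParent T x y ⊎ IsParent T y x

data WalkIn {k : ℕ} (T : RootedTree k) (S : Fin (suc k) → Set)
     : Fin (suc k) → Fin (suc k) → Set where
  here : ∀ {x} → S x → WalkIn T S x x
  step : ∀ {x y z} → S x → TAdj T x y → WalkIn T S y z → WalkIn T S x z

ConnectedNonEmpty : ∀ {k} → RootedTree k → (Fin (suc k) → Set) → Set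
ConnectedNonEmpty {k} T S =
  (∃ λ x → S x) × (∀ x y → S x → S y → WalkIn T S x y)

record RootedTD {n : ℕ} (G : Graph n) : Set where
  field
    k     : ℕ
    tree  : RootedTree k
    bag   : Fin (suc k) → Subset n
    edge-covered : ∀ u v → Adj G u v → ∃ λ x → (u ∈ bag x) × (v ∈ bag x)
    vertex-connected : ∀ v → ConnectedNonEmpty tree (λ x → v ∈ bag x)

open RootedTD public

order : ∀ {n} {G : Graph n} → RootedTD G → ℕ
order D = suc (k D)

WidthAtMost : ∀ {n} {G : Graph n} → RootedTD G → ℕ → Set
WidthAtMost D w = ∀ x → ∣ bag D x ∣ ≤ suc w

Slick : ∀ {n} {G : Graph n} → RootedTD G → Set
Slick {n} {G} D =
  ∀ x y → IsParent (tree D) x y → ∀ v → v ∈ bag D x → v ∈ bag D y →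
  ∃ λ u → Adj G v u × (u ∈ bag D y) × (u ∉ bag D x)

-- Let m = ℓ − 1, so every bag has at most m vertices. Assign each vertex v to its owner, the
-- topmost node whose bag contains v; the fibre of a node is the set of vertices it owns, and a
-- child's bag lies in its fibre together with its parent's bag. A node is light if its fibre
-- has fewer than m vertices. Nodes are processed from the largest index down (parents have
-- smaller indices). At node t, two light children are merged while there are two, since their
-- union lies in two light fibres and the bag of t, so has fewer than 3m vertices; a last light
-- child is merged into t, giving fewer than 2m vertices. When all nodes are processed, every
-- non-root node has a fibre of at least m vertices and a bag of fewer than 3m; a light root is
-- merged with a child, giving a bag of at most 4m − 2 = 4ℓ − 6 vertices. Each merge is the
-- contraction of a tree-decomposition along a tree map that collapses or keeps each edge, and
-- such contractions preserve slickness. Finally the fibres partition V(G), so (order) · m ≤ n.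

module Submission where

open import Defs hiding (sym)
open import Data.Bool using (Bool; true; false; if_then_else_)
open import Data.Empty using (⊥-elim)
open import Data.Fin as Fin using (Fin; toℕ; punchIn; punchOut) renaming (zero to fzero; suc to fsuc)
open import Data.Fin.Induction using (<-wellFounded)
open import Data.Fin.Properties using (_≟_; any?; suc-injective; toℕ-injective; toℕ<n; punchInᵢ≢i; punchIn-punchOut; punchOut-punchIn; punchOut-cong; punchOut-injective; punchOut-mono-≤; ≤∧≢⇒<)
open import Data.Fin.Subset using (Subset; _∈_; _⊆_; _∪_; ∣_∣; ⊤; inside; outside)
open import Data.Fin.Subset.Properties using (_∈?_; x∈p∪q⁺; x∈p∪q⁻; p⊆p∪q; q⊆p∪q; p⊆q⇒∣p∣≤∣q∣; ∣p∣≤∣x∷p∣; ∣⊤∣≡n)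
open import Data.Nat using (ℕ; zero; suc; _+_; _*_; _∸_; _≤_; _<_; z≤n; s≤s; _≤?_; _<?_)
open import Data.Nat.Properties as ℕ using (≤-refl; ≤-trans; <-trans; <⇒≤; <⇒≢; <⇒≱; ≤-<-trans; <-≤-trans; ≰⇒>; +-suc; +-mono-≤; +-monoʳ-≤; +-monoˡ-≤; +-mono-<; +-monoˡ-<; m<n⇒m<1+n; m<1+n⇒m<n∨m≡n; m≤n⇒m<n∨m≡n; module ≤-Reasoning)
open import Algebra.Properties.CommutativeMonoid.Sum ℕ.+-0-commutativeMonoid using (sum; sum-cong-≗; ∑-distrib-+; sum-replicate-zero)
open import Data.Nat.Tactic.RingSolver using (solve-∀)
open import Data.Product using (Σ; ∃; _×_; _,_; proj₁; proj₂)
open import Data.Sum as Sum using (_⊎_; inj₁; inj₂; [_,_]′)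
open import Data.Vec using (_∷_; []; tabulate)
open import Data.Vec.Properties using (lookup∘tabulate; lookup⇒[]=; []=⇒lookup)
open import Function using (_∘_)
open import Induction.WellFounded using (Acc; acc)
open import Relation.Binary.Definitions using (tri<; tri≈; tri>)
open import Relation.Binary.PropositionalEquality using (_≡_; _≢_; refl; sym; trans; cong; cong₂; subst; subst₂; module ≡-Reasoning)
open import Relation.Nullary using (¬_; Dec; yes; no; does; proof; invert; Reflects; contradiction)
open import Relation.Nullary.Decidable using (dec-true; decidable-stable; ¬?; _×-dec_)
open import Relation.Unary using (Decidable)

module _ {k : ℕ} (T : RootedTree k) where

  data Descendant (x : Fin (suc k)) : Fin (suc k) → Set where
    self  : Descendant x x
    child : ∀ j → Descendant x (par T j) → Descendant x (fsuc j)

  descendant⇒≤ : ∀ {x y} → Descendant x y → toℕ x ≤ toℕ y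
  descendant⇒≤ self        = ≤-refl
  descendant⇒≤ (child j d) = ≤-trans (descendant⇒≤ d) (<⇒≤ (par-lt T j))

  ¬descendant-parent : ∀ j → ¬ Descendant (fsuc j) (par T j)
  ¬descendant-parent j d = <⇒≱ (par-lt T j) (descendant⇒≤ d)

  Topmost : (Fin (suc k) → Set) → Fin (suc k) → Set
  Topmost S y = S y × (∀ j → y ≡ fsuc j → ¬ S (par T j))

  topmost : ∀ {S} → Decidable S → ∀ {y} → S y → ∃ (Topmost S)
  topmost {S} S? {y} = go y (<-wellFounded y)
    where
    go : ∀ y → Acc Fin._<_ y → S y → ∃ (Topmost S)
    go fzero    _        s = fzero , s , λ _ ()
    go (fsuc j) (acc rs) s with S? (par T j)
    ... | yes s′ = go (par T j) (rs (par-lt T j)) s′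
    ... | no ¬s′ = fsuc j , s , λ { _ refl → ¬s′ }

  topmost⊎parent : ∀ {S} → Decidable S → ∀ {y} → S y → Topmost S y ⊎ ∃ λ j → y ≡ fsuc j × S (par T j)
  topmost⊎parent S? {fzero}  s = inj₁ (s , λ _ ())
  topmost⊎parent S? {fsuc j} s with S? (par T j)
  ... | yes s′ = inj₂ (j , refl , s′)
  ... | no ¬s′ = inj₁ (s , λ { _ refl → ¬s′ })

  walk-source : ∀ {S x w} → WalkIn T S x w → S x
  walk-source (here s)     = s
  walk-source (step s _ _) = s

  walk-below-topmost : ∀ {S y x w} → Topmost S y → Descendant y x → WalkIn T S x w → Descendant y w
  walk-below-topmost top d (here _) = d
  walk-below-topmost top d (step _ (inj₁ (j , refl , refl)) W) = walk-below-topmost top (child j d) W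
  walk-below-topmost top self (step _ (inj₂ (j , refl , refl)) W) = ⊥-elim (proj₂ top j refl (walk-source W))
  walk-below-topmost top (child _ d) (step _ (inj₂ (j , refl , refl)) W) = walk-below-topmost top d W

  topmost-is-ancestor : ∀ {S y} → ConnectedNonEmpty T S → Topmost S y → ∀ {w} → S w → Descendant y w
  topmost-is-ancestor (_ , walk) top s = walk-below-topmost top self (walk _ _ (proj₁ top) s)

  topmost-unique : ∀ {S y z} → ConnectedNonEmpty T S → Topmost S y → Topmost S z → y ≡ z
  topmost-unique conn top-y top-z = toℕ-injective (ℕ.≤-antisym
    (descendant⇒≤ (topmost-is-ancestor conn top-y (proj₁ top-z)))
    (descendant⇒≤ (topmost-is-ancestor conn top-z (proj₁ top-y))))

-- RootedTD G indexed by its number of non-root nodes, so that merging nodes is recursion on the index.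
record TreeDecomposition {n} (G : Graph n) (k : ℕ) : Set where
  field
    tree             : RootedTree k
    bag              : Fin (suc k) → Subset n
    edge-covered     : ∀ u v → Adj G u v → ∃ λ x → (u ∈ bag x) × (v ∈ bag x)
    vertex-connected : ∀ v → ConnectedNonEmpty tree (λ x → v ∈ bag x)

open TreeDecomposition public

module _ {n} {G : Graph n} where

  toRootedTD : ∀ {k} → TreeDecomposition G k → RootedTD G
  toRootedTD {k} E = record
    { k = k ; tree = tree E ; bag = bag E
    ; edge-covered = edge-covered E ; vertex-connected = vertex-connected E }

  fromRootedTD : (D : RootedTD G) → TreeDecomposition G (RootedTD.k D)
  fromRootedTD D = record
    { tree = tree D ; bag = bag D
    ; edge-covered = edge-covered D ; vertex-connected = vertex-connected D }

module _ {n} {G : Graph n} {k} (E : TreeDecomposition G k) where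

  InParentBag : Fin n → Fin (suc k) → Set
  InParentBag v z = Σ (Fin k) λ j → z ≡ fsuc j × v ∈ bag E (par (tree E) j)

  -- Satisfied when own v is the topmost node whose bag contains v.
  Ownership : (Fin n → Fin (suc k)) → Set
  Ownership own = ∀ v z → v ∈ bag E z → own v ≡ z ⊎ InParentBag v z

  topmost-bag-is-ancestor : ∀ {v y w} → Topmost (tree E) (λ z → v ∈ bag E z) y → v ∈ bag E w →
                            Descendant (tree E) y w
  topmost-bag-is-ancestor {v} top = topmost-is-ancestor (tree E) (vertex-connected E v) top

-- The hypotheses say that bag′ z is the union of the bags B y with π y = z.
module Contraction {n} {G : Graph n} {k k′} (E : TreeDecomposition G k) (T′ : RootedTree k′)
    (π : Fin (suc k) → Fin (suc k′)) (bag′ : Fin (suc k′) → Subset n)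
    (bag′-preimage : ∀ {v z} → v ∈ bag′ z → ∃ λ y → π y ≡ z × v ∈ bag E y)
    (bag-image : ∀ {v y} → v ∈ bag E y → v ∈ bag′ (π y))
    (π-edge : ∀ j → π (fsuc j) ≡ π (par (tree E) j) ⊎ IsParent T′ (π (par (tree E) j)) (π (fsuc j)))
  where

  private
    T = tree E
    B = bag E

  map-walk : ∀ {v x y} → WalkIn T (λ z → v ∈ B z) x y → WalkIn T′ (λ z → v ∈ bag′ z) (π x) (π y)
  map-walk (here s) = here (bag-image s)
  map-walk (step s (inj₁ (j , refl , refl)) W) with π-edge j
  ... | inj₁ collapsed rewrite sym collapsed = map-walk W
  ... | inj₂ edge = step (bag-image s) (inj₁ edge) (map-walk W)
  map-walk (step s (inj₂ (j , refl , refl)) W) with π-edge j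
  ... | inj₁ collapsed rewrite collapsed = map-walk W
  ... | inj₂ edge = step (bag-image s) (inj₂ edge) (map-walk W)

  map-descendant : ∀ {x y} → Descendant T x y → Descendant T′ (π x) (π y)
  map-descendant self = self
  map-descendant (child j d) with π-edge j
  ... | inj₁ collapsed rewrite collapsed = map-descendant d
  ... | inj₂ (j′ , π-child , π-parent) rewrite π-child =
    child j′ (subst (Descendant T′ _) (sym π-parent) (map-descendant d))

  contracted : TreeDecomposition G k′
  contracted = record
    { tree = T′
    ; bag = bag′
    ; edge-covered = λ u v uv → let (x , u∈x , v∈x) = edge-covered E u v uv in π x , bag-image u∈x , bag-image v∈x
    ; vertex-connected = λ v → let ((x , v∈x) , walk) = vertex-connected E v in
        (π x , bag-image v∈x) , λ x′ y′ v∈x′ v∈y′ →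
          let (x , πx≡x′ , v∈x) = bag′-preimage v∈x′
              (y , πy≡y′ , v∈y) = bag′-preimage v∈y′
          in subst₂ (WalkIn T′ _) πx≡x′ πy≡y′ (map-walk (walk x y v∈x v∈y))
    }

  private
    no-descendant-at-parent : ∀ {j′ y w} → π y ≡ fsuc j′ → π w ≡ par T′ j′ → ¬ Descendant T y w
    no-descendant-at-parent {j′} πy πw d =
      ¬descendant-parent T′ j′ (subst₂ (Descendant T′) πy πw (map-descendant d))

    not-topmost : ∀ {v j′ y} → π y ≡ fsuc j′ → v ∈ bag′ (par T′ j′) → ¬ Topmost T (λ z → v ∈ B z) y
    not-topmost πy v∈x′ top =
      let (w , πw , v∈w) = bag′-preimage v∈x′ in no-descendant-at-parent πy πw (topmost-bag-is-ancestor E top v∈w)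

  -- Let y be topmost in E among the nodes mapped to the child node with v ∈ B y. Since v lies in
  -- the parent node's bag, y is not topmost for v, so v ∈ B (par y) and the edge above y is not
  -- collapsed. Slickness of E there gives u ∈ B y ∖ B (par y); then y is topmost for u, so u is
  -- not in the parent node's bag.
  slick-contracted : Slick (toRootedTD E) → Slick (toRootedTD contracted)
  slick-contracted slick ._ ._ (j′ , refl , refl) v v∈x′ v∈y′
    with bag′-preimage v∈y′
  ... | y₀ , πy₀ , v∈y₀
    with topmost T (λ y → π y ≟ fsuc j′ ×-dec v ∈? B y) (πy₀ , v∈y₀)
  ... | y , (πy , v∈y) , top
    with topmost⊎parent T (λ z → v ∈? B z) v∈y
  ... | inj₁ top′ = ⊥-elim (not-topmost πy v∈x′ top′)
  ... | inj₂ (j , refl , v∈p)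
    with π-edge j
  ... | inj₁ collapsed = ⊥-elim (top j refl (trans (sym collapsed) πy , v∈p))
  ... | inj₂ _ =
    let (u , vu , u∈y , u∉p) = slick (par T j) (fsuc j) (j , refl , refl) v v∈p v∈y
    in u , vu , subst (λ z → u ∈ bag′ z) πy (bag-image u∈y) ,
       λ u∈x′ → not-topmost πy u∈x′ (u∈y , λ { _ refl → u∉p })

  ownership-contracted : ∀ {own} → Ownership E own → Ownership contracted (π ∘ own)
  ownership-contracted {own} owns v z v∈z with bag′-preimage v∈z
  ... | y , refl , v∈y = go y (<-wellFounded y) v∈y
    where
    go : ∀ y → Acc Fin._<_ y → v ∈ B y → π (own v) ≡ π y ⊎ InParentBag contracted v (π y)
    go y _ v∈y with owns v y v∈y
    ... | inj₁ own≡y = inj₁ (cong π own≡y)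
    go .(fsuc j) (acc rs) _ | inj₂ (j , refl , v∈p) with π-edge j
    ... | inj₁ collapsed rewrite collapsed = go (par T j) (rs (par-lt T j)) v∈p
    ... | inj₂ (j′ , π-child , π-parent) =
      inj₂ (j′ , π-child , subst (λ x → v ∈ bag′ x) (sym π-parent) (bag-image v∈p))

∣p∪q∣≤∣p∣+∣q∣ : ∀ {n} (p q : Subset n) → ∣ p ∪ q ∣ ≤ ∣ p ∣ + ∣ q ∣
∣p∪q∣≤∣p∣+∣q∣ []            []            = z≤n
∣p∪q∣≤∣p∣+∣q∣ (inside ∷ p)  (x ∷ q)       = s≤s (≤-trans (∣p∪q∣≤∣p∣+∣q∣ p q) (+-monoʳ-≤ ∣ p ∣ (∣p∣≤∣x∷p∣ x q)))
∣p∪q∣≤∣p∣+∣q∣ (outside ∷ p) (inside ∷ q)  =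
  ≤-trans (s≤s (∣p∪q∣≤∣p∣+∣q∣ p q)) (ℕ.≤-reflexive (sym (+-suc ∣ p ∣ ∣ q ∣)))
∣p∪q∣≤∣p∣+∣q∣ (outside ∷ p) (outside ∷ q) = ∣p∪q∣≤∣p∣+∣q∣ p q

∪-⊆ : ∀ {n} (p q : Subset n) {r} → p ⊆ r → q ⊆ r → p ∪ q ⊆ r
∪-⊆ p q p⊆r q⊆r x∈ = [ p⊆r , q⊆r ]′ (x∈p∪q⁻ p q x∈)

∣p∪q∪r∣≤∣p∣+∣q∣+∣r∣ : ∀ {n} (p q r : Subset n) → ∣ (p ∪ q) ∪ r ∣ ≤ ∣ p ∣ + ∣ q ∣ + ∣ r ∣
∣p∪q∪r∣≤∣p∣+∣q∣+∣r∣ p q r = ≤-trans (∣p∪q∣≤∣p∣+∣q∣ (p ∪ q) r) (+-monoˡ-≤ ∣ r ∣ (∣p∪q∣≤∣p∣+∣q∣ p q))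

module _ {n : ℕ} where

  fibre : ∀ {K} → (Fin n → Fin K) → Fin K → Subset n
  fibre f z = tabulate (λ v → does (f v ≟ z))

  ∈-fibre⁺ : ∀ {K} (f : Fin n → Fin K) {z v} → f v ≡ z → v ∈ fibre f z
  ∈-fibre⁺ f {z} {v} fv≡z = lookup⇒[]= v _ (trans (lookup∘tabulate _ v) (dec-true (f v ≟ z) fv≡z))

  ∈-fibre⁻ : ∀ {K} (f : Fin n → Fin K) {z v} → v ∈ fibre f z → f v ≡ z
  ∈-fibre⁻ f {z} {v} v∈ =
    invert (subst (Reflects _) (trans (sym (lookup∘tabulate _ v)) ([]=⇒lookup v∈)) (proof (f v ≟ z)))

  module _ {K K′} (π : Fin K → Fin K′) (f : Fin n → Fin K) where

    ∣fibre∣≤∣fibre-∘∣ : ∀ {w z} → π w ≡ z → ∣ fibre f w ∣ ≤ ∣ fibre (π ∘ f) z ∣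
    ∣fibre∣≤∣fibre-∘∣ {w} {z} πw≡z = p⊆q⇒∣p∣≤∣q∣ {p = fibre f w} {q = fibre (π ∘ f) z}
      λ v∈ → ∈-fibre⁺ (π ∘ f) (trans (cong π (∈-fibre⁻ f v∈)) πw≡z)

    ∣fibre-∘∣≡∣fibre∣ : ∀ {w z} → π w ≡ z → (∀ y → π y ≡ z → y ≡ w) → ∣ fibre (π ∘ f) z ∣ ≡ ∣ fibre f w ∣
    ∣fibre-∘∣≡∣fibre∣ {w} {z} πw≡z unique = ℕ.≤-antisym
      (p⊆q⇒∣p∣≤∣q∣ {p = fibre (π ∘ f) z} {q = fibre f w} λ v∈ → ∈-fibre⁺ f (unique _ (∈-fibre⁻ (π ∘ f) v∈)))
      (∣fibre∣≤∣fibre-∘∣ πw≡z)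

private
  δ : ∀ {K} → Fin K → Fin K → ℕ
  δ x z = if does (x ≟ z) then 1 else 0

  ∑δ≡1 : ∀ {K} (x : Fin K) → sum (δ x) ≡ 1
  ∑δ≡1 {suc K} fzero    = cong suc (sum-replicate-zero K)
  ∑δ≡1 {suc K} (fsuc x) = ∑δ≡1 x

  ∣b∷p∣ : ∀ {n} (b : Bool) (p : Subset n) → ∣ b ∷ p ∣ ≡ (if b then 1 else 0) + ∣ p ∣
  ∣b∷p∣ true  p = refl
  ∣b∷p∣ false p = refl

∑∣fibre∣≡n : ∀ {n K} (f : Fin n → Fin K) → sum (λ z → ∣ fibre f z ∣) ≡ n
∑∣fibre∣≡n {zero}  {K} f = sum-replicate-zero K
∑∣fibre∣≡n {suc n} {K} f = begin
  sum (λ z → ∣ fibre f z ∣)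
    ≡⟨ sum-cong-≗ (λ z → ∣b∷p∣ (does (f fzero ≟ z)) (fibre (f ∘ fsuc) z)) ⟩
  sum (λ z → δ (f fzero) z + ∣ fibre (f ∘ fsuc) z ∣)
    ≡⟨ ∑-distrib-+ (δ (f fzero)) _ ⟩
  sum (δ (f fzero)) + sum (λ z → ∣ fibre (f ∘ fsuc) z ∣)
    ≡⟨ cong₂ _+_ (∑δ≡1 (f fzero)) (∑∣fibre∣≡n (f ∘ fsuc)) ⟩
  suc n
    ∎
  where open ≡-Reasoning

∑-lowerBound : ∀ {K} m (g : Fin K → ℕ) → (∀ z → m ≤ g z) → K * m ≤ sum g
∑-lowerBound {zero}  m g m≤g = z≤n
∑-lowerBound {suc K} m g m≤g = +-mono-≤ (m≤g fzero) (∑-lowerBound m (g ∘ fsuc) (m≤g ∘ fsuc))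

large-fibres⇒K*m≤n : ∀ {n K m} (f : Fin n → Fin K) → (∀ z → m ≤ ∣ fibre f z ∣) → K * m ≤ n
large-fibres⇒K*m≤n {m = m} f large = subst (_ ≤_) (∑∣fibre∣≡n f) (∑-lowerBound m _ large)

toℕ-punchOut-< : ∀ {m} {i j : Fin (suc m)} (i≢j : i ≢ j) → toℕ j < toℕ i → toℕ (punchOut i≢j) ≡ toℕ j
toℕ-punchOut-< {_} {fzero}  {fzero}  i≢j _ = contradiction refl i≢j
toℕ-punchOut-< {suc m} {fsuc i} {fzero}  i≢j _ = refl
toℕ-punchOut-< {suc m} {fsuc i} {fsuc j} i≢j (s≤s j<i) = cong suc (toℕ-punchOut-< (i≢j ∘ cong fsuc) j<i)

toℕ-punchIn-< : ∀ {m} (i : Fin (suc m)) (j : Fin m) → toℕ j < toℕ i → toℕ (punchIn i j) ≡ toℕ j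
toℕ-punchIn-< (fsuc i) fzero    _         = refl
toℕ-punchIn-< (fsuc i) (fsuc j) (s≤s j<i) = cong suc (toℕ-punchIn-< i j j<i)

toℕ≤toℕ-punchIn : ∀ {m} (i : Fin (suc m)) (j : Fin m) → toℕ j ≤ toℕ (punchIn i j)
toℕ≤toℕ-punchIn fzero    j        = ℕ.n≤1+n (toℕ j)
toℕ≤toℕ-punchIn (fsuc i) fzero    = z≤n
toℕ≤toℕ-punchIn (fsuc i) (fsuc j) = s≤s (toℕ≤toℕ-punchIn i j)

punchOut-mono-< : ∀ {m} {i j l : Fin (suc m)} (i≢j : i ≢ j) (i≢l : i ≢ l) →
                  toℕ j < toℕ l → toℕ (punchOut i≢j) < toℕ (punchOut i≢l)
punchOut-mono-< i≢j i≢l j<l = ≤∧≢⇒<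
  (punchOut-mono-≤ i≢j i≢l (<⇒≤ j<l))
  (λ eq → <⇒≢ j<l (cong toℕ (punchOut-injective i≢j i≢l eq)))

-- Deletes node b, adding its bag to that of a, its parent or an earlier sibling; π renumbers the
-- nodes other than b by punchOut b and sends b to the image a′ of a.
module Merge {n} {G : Graph n} {k} (E : TreeDecomposition G (suc k)) (jb : Fin (suc k)) (a : Fin (suc (suc k)))
    (a<b : toℕ a < toℕ (fsuc jb))
    (parent-or-sibling : a ≡ par (tree E) jb ⊎ ∃ λ ja → a ≡ fsuc ja × par (tree E) ja ≡ par (tree E) jb)
  where

  private
    T = tree E
    B = bag E

  b : Fin (suc (suc k))
  b = fsuc jb

  b≢a : b ≢ a
  b≢a b≡a = <⇒≢ a<b (cong toℕ (sym b≡a))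

  a′ : Fin (suc k)
  a′ = punchOut b≢a

  π : Fin (suc (suc k)) → Fin (suc k)
  π y with b ≟ y
  ... | yes _   = a′
  ... | no b≢y  = punchOut b≢y

  π-≢ : ∀ {y} (b≢y : b ≢ y) → π y ≡ punchOut b≢y
  π-≢ {y} b≢y with b ≟ y
  ... | yes b≡y = contradiction b≡y b≢y
  ... | no _    = punchOut-cong b {y} refl

  π-b : π b ≡ a′
  π-b with b ≟ b
  ... | yes _  = refl
  ... | no b≢b = contradiction refl b≢b

  π-a : π a ≡ a′
  π-a = π-≢ b≢a

  π-punchIn : ∀ z → π (punchIn b z) ≡ z
  π-punchIn z = trans (π-≢ (punchInᵢ≢i b z ∘ sym)) (punchOut-punchIn b)

  punchIn-a′ : punchIn b a′ ≡ a
  punchIn-a′ = punchIn-punchOut b≢a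

  π⁻¹ : ∀ {y z} → π y ≡ z → z ≢ a′ → y ≡ punchIn b z
  π⁻¹ {y} πy≡z z≢a′ with b ≟ y
  ... | yes _  = contradiction (sym πy≡z) z≢a′
  ... | no b≢y = trans (sym (punchIn-punchOut b≢y)) (cong (punchIn b) πy≡z)

  π⁻¹-a′ : ∀ {y} → π y ≡ a′ → y ≡ a ⊎ y ≡ b
  π⁻¹-a′ {y} πy≡a′ with b ≟ y
  ... | yes b≡y = inj₂ (sym b≡y)
  ... | no b≢y  = inj₁ (punchOut-injective b≢y b≢a πy≡a′)

  toℕ-π : ∀ {y} → toℕ y < toℕ b → toℕ (π y) ≡ toℕ y
  toℕ-π y<b = trans (cong toℕ (π-≢ b≢y)) (toℕ-punchOut-< b≢y y<b)
    where b≢y = λ b≡y → <⇒≢ y<b (cong toℕ (sym b≡y))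

  toℕ-a′ : toℕ a′ ≡ toℕ a
  toℕ-a′ = toℕ-punchOut-< b≢a a<b

  π-mono : ∀ {p y} → b ≢ y → toℕ p < toℕ y → toℕ (π p) < toℕ (π y)
  π-mono {p} {y} b≢y p<y rewrite π-≢ b≢y with b ≟ p
  ... | yes refl = punchOut-mono-< b≢a b≢y (<-trans a<b p<y)
  ... | no b≢p   = punchOut-mono-< b≢p b≢y p<y

  tree′ : RootedTree k
  tree′ = record
    { par    = λ j′ → π (par T (punchIn jb j′))
    ; par-lt = λ j′ → subst (λ z → toℕ (π (par T (punchIn jb j′))) < toℕ z) (π-punchIn (fsuc j′))
                        (π-mono (punchInᵢ≢i b (fsuc j′) ∘ sym) (par-lt T (punchIn jb j′)))
    }

  bag′ : Fin (suc k) → Subset n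
  bag′ z with z ≟ a′
  ... | yes _ = B a ∪ B b
  ... | no _  = B (punchIn b z)

  bag′-a′ : bag′ a′ ≡ B a ∪ B b
  bag′-a′ with a′ ≟ a′
  ... | yes _    = refl
  ... | no a′≢a′ = contradiction refl a′≢a′

  bag′-≢ : ∀ {z} → z ≢ a′ → bag′ z ≡ B (punchIn b z)
  bag′-≢ {z} z≢a′ with z ≟ a′
  ... | yes z≡a′ = contradiction z≡a′ z≢a′
  ... | no _     = refl

  bag′-preimage : ∀ {v z} → v ∈ bag′ z → ∃ λ y → π y ≡ z × v ∈ B y
  bag′-preimage {v} {z} v∈ with z ≟ a′
  ... | no _ = punchIn b z , π-punchIn z , v∈
  ... | yes refl with x∈p∪q⁻ (B a) (B b) v∈
  ...   | inj₁ v∈a = a , π-a , v∈a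
  ...   | inj₂ v∈b = b , π-b , v∈b

  bag-image : ∀ {v y} → v ∈ B y → v ∈ bag′ (π y)
  bag-image {v} {y} v∈y with π y ≟ a′
  ... | yes πy≡a′ = Sum.[ (λ y≡a → x∈p∪q⁺ (inj₁ (subst (λ x → v ∈ B x) y≡a v∈y)))
                    , (λ y≡b → x∈p∪q⁺ (inj₂ (subst (λ x → v ∈ B x) y≡b v∈y))) ]′ (π⁻¹-a′ πy≡a′)
  ... | no πy≢a′  = subst (λ x → v ∈ B x) (π⁻¹ refl πy≢a′) v∈y

  private
    π-edge-≢ : ∀ j → j ≢ jb → IsParent tree′ (π (par T j)) (π (fsuc j))
    π-edge-≢ j j≢jb = punchOut jb≢j , π-≢ (jb≢j ∘ suc-injective) , cong (π ∘ par T) (punchIn-punchOut jb≢j)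
      where jb≢j = j≢jb ∘ sym

    π-edge-b : π b ≡ π (par T jb) ⊎ IsParent tree′ (π (par T jb)) (π b)
    π-edge-b = Sum.map
      (λ a≡p → trans π-b (trans (sym π-a) (cong π a≡p)))
      (λ (ja , a≡ja , p≡p) → subst₂ (IsParent tree′) (cong π p≡p) (trans (cong π (sym a≡ja)) (trans π-a (sym π-b)))
                               (π-edge-≢ ja (λ ja≡jb → b≢a (trans (cong fsuc (sym ja≡jb)) (sym a≡ja)))))
      parent-or-sibling

  π-edge : ∀ j → π (fsuc j) ≡ π (par T j) ⊎ IsParent tree′ (π (par T j)) (π (fsuc j))
  π-edge j with j ≟ jb
  ... | no j≢jb  = inj₂ (π-edge-≢ j j≢jb)
  ... | yes refl = π-edge-b

  open Contraction E tree′ π bag′ bag′-preimage bag-image π-edge public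
    using ()
    renaming (contracted to merged; slick-contracted to slick-merged; ownership-contracted to ownership-merged)

  a′-parent : ∀ {j′} → fsuc j′ ≡ a′ → a ≡ fsuc (punchIn jb j′) × toℕ (par tree′ j′) ≡ toℕ (par T (punchIn jb j′))
  a′-parent {j′} j′≡a′ = a≡ , toℕ-π (<-trans (par-lt T (punchIn jb j′)) (subst (λ x → toℕ x < toℕ b) a≡ a<b))
    where a≡ = sym (trans (cong (punchIn b) j′≡a′) punchIn-a′)

  module _ (own : Fin n → Fin (suc (suc k))) where

    ∣fibre∣-≢a′ : ∀ {z} → z ≢ a′ → ∣ fibre (π ∘ own) z ∣ ≡ ∣ fibre own (punchIn b z) ∣
    ∣fibre∣-≢a′ {z} z≢a′ = ∣fibre-∘∣≡∣fibre∣ π own (π-punchIn z) (λ _ πy≡z → π⁻¹ πy≡z z≢a′)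

    ∣fibre-b∣≤∣fibre-a′∣ : ∣ fibre own b ∣ ≤ ∣ fibre (π ∘ own) a′ ∣
    ∣fibre-b∣≤∣fibre-a′∣ = ∣fibre∣≤∣fibre-∘∣ π own π-b

x<m∧y<m∧z≤m⇒x+y+z<3m : ∀ {m x y z} → x < m → y < m → z ≤ m → x + y + z < 3 * m
x<m∧y<m∧z≤m⇒x+y+z<3m {m} {x} {y} {z} x<m y<m z≤m = begin-strict
  x + y + z  <⟨ +-monoˡ-< z (+-mono-< x<m y<m) ⟩
  m + m + z  ≤⟨ +-monoʳ-≤ (m + m) z≤m ⟩
  m + m + m  ≡⟨ 3m m ⟩
  3 * m      ∎
  where
  open ≤-Reasoning
  3m : ∀ m → m + m + m ≡ 3 * m
  3m = solve-∀

x<m∧y<3m⇒2+x+y≤4m : ∀ {m x y} → x < m → y < 3 * m → 2 + (x + y) ≤ 4 * m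
x<m∧y<3m⇒2+x+y≤4m {m} {x} {y} x<m y<3m = begin
  2 + (x + y)    ≡⟨ cong suc (sym (+-suc x y)) ⟩
  suc x + suc y  ≤⟨ +-mono-≤ x<m y<3m ⟩
  m + 3 * m      ≡⟨ 4m m ⟩
  4 * m          ∎
  where
  open ≤-Reasoning
  4m : ∀ m → m + 3 * m ≡ 4 * m
  4m = solve-∀

module _ {n} {G : Graph n} {k} (E : TreeDecomposition G k) {own : Fin n → Fin (suc k)} (owns : Ownership E own)
  where

  bag⊆fibre∪parent : ∀ j → bag E (fsuc j) ⊆ fibre own (fsuc j) ∪ bag E (par (tree E) j)
  bag⊆fibre∪parent j {v} v∈ with owns v (fsuc j) v∈
  ... | inj₁ own≡ = x∈p∪q⁺ (inj₁ (∈-fibre⁺ own own≡))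
  ... | inj₂ (_ , refl , v∈p) = x∈p∪q⁺ (inj₂ v∈p)

  root-bag⊆fibre : bag E fzero ⊆ fibre own fzero
  root-bag⊆fibre {v} v∈ with owns v fzero v∈
  ... | inj₁ own≡ = ∈-fibre⁺ own own≡
  ... | inj₂ (_ , () , _)

module Coarsening {n} {G : Graph n} (m : ℕ) (0<m : 0 < m) where

  Light : ∀ {k} → (Fin n → Fin (suc k)) → Fin (suc k) → Set
  Light own z = ∣ fibre own z ∣ < m

  Finished : ∀ {k} → TreeDecomposition G k → (Fin n → Fin (suc k)) → Fin (suc k) → Set
  Finished E own z = m ≤ ∣ fibre own z ∣ × ∣ bag E z ∣ < 3 * m

  -- A light node hanging from an unprocessed node (index < s) is merged when that node is processed.
  Settled : ∀ {k} → ℕ → (E : TreeDecomposition G k) → (Fin n → Fin (suc k)) → Fin k → Set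
  Settled s E own j = Finished E own (fsuc j) ⊎ (Light own (fsuc j) × toℕ (par (tree E) j) < s)

  record Processed {k} (s : ℕ) (E : TreeDecomposition G k) (own : Fin n → Fin (suc k)) : Set where
    field
      slick     : Slick (toRootedTD E)
      ownership : Ownership E own
      small     : ∀ y → toℕ y < s → ∣ bag E y ∣ ≤ m
      settled   : ∀ j → s ≤ toℕ (fsuc j) → Settled s E own j
      root      : s ≡ 0 → ∣ bag E fzero ∣ < 3 * m

  ProcessedTD : ℕ → Set
  ProcessedTD s = Σ ℕ λ k → Σ (TreeDecomposition G k) λ E → Σ (Fin n → Fin (suc k)) (Processed s E)

  LightChild : ∀ {k} → ℕ → (E : TreeDecomposition G k) → (Fin n → Fin (suc k)) → Fin k → Set
  LightChild t E own j = toℕ (par (tree E) j) ≡ t × Light own (fsuc j)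

  lightChild? : ∀ {k} t (E : TreeDecomposition G k) own → Decidable (LightChild t E own)
  lightChild? t E own j = toℕ (par (tree E) j) ℕ.≟ t ×-dec ∣ fibre own (fsuc j) ∣ <? m

  small⇒<3m : ∀ {x} → x ≤ m → x < 3 * m
  small⇒<3m = x<m∧y<m∧z≤m⇒x+y+z<3m 0<m 0<m

  settle : ∀ {k s} {E : TreeDecomposition G k} {own} j →
           ∣ bag E (fsuc j) ∣ < 3 * m → toℕ (par (tree E) j) < s → Settled s E own j
  settle {own = own} j bag<3m par<s with m ≤? ∣ fibre own (fsuc j) ∣
  ... | yes heavy = inj₁ (heavy , bag<3m)
  ... | no ¬heavy = inj₂ (≰⇒> ¬heavy , par<s)

  settled-below : ∀ {k t} {E : TreeDecomposition G k} {own j} →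
                  Settled (suc t) E own j → ¬ LightChild t E own j → Settled t E own j
  settled-below (inj₁ finished) _ = inj₁ finished
  settled-below (inj₂ (light , par<1+t)) ¬lc with m<1+n⇒m<n∨m≡n par<1+t
  ... | inj₁ par<t = inj₂ (light , par<t)
  ... | inj₂ par≡t = contradiction (par≡t , light) ¬lc

  no-light-child : ∀ {k t} {E : TreeDecomposition G k} {own} →
                   Processed (suc t) E own → (∀ j → ¬ LightChild t E own j) → Processed t E own
  no-light-child {t = t} {E} {own} p none = record
    { slick = slick ; ownership = ownership
    ; small = λ y y<t → small y (m<n⇒m<1+n y<t)
    ; settled = settled′
    ; root = λ _ → small⇒<3m (small fzero (s≤s z≤n))
    }
    where
    open Processed p
    settled′ : ∀ j → t ≤ toℕ (fsuc j) → Settled t E own j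
    settled′ j t≤j with m≤n⇒m<n∨m≡n t≤j
    ... | inj₁ t<j = settled-below {E = E} {own} (settled j t<j) (none j)
    ... | inj₂ t≡j = settle {E = E} {own} j (small⇒<3m (small (fsuc j) (ℕ.≤-reflexive (cong suc (sym t≡j)))))
                                            (subst (_ <_) (sym t≡j) (par-lt (tree E) j))

  module _ {k} (E : TreeDecomposition G k) {own : Fin n → Fin (suc k)} (owns : Ownership E own) where

    siblings-bag<3m : ∀ {ja jb} → par (tree E) ja ≡ par (tree E) jb → Light own (fsuc ja) → Light own (fsuc jb) →
                      ∣ bag E (par (tree E) jb) ∣ ≤ m → ∣ bag E (fsuc ja) ∪ bag E (fsuc jb) ∣ < 3 * m
    siblings-bag<3m {ja} {jb} pa≡pb light-a light-b small = ≤-<-trans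
      (p⊆q⇒∣p∣≤∣q∣ B⊆)
      (≤-<-trans (∣p∪q∪r∣≤∣p∣+∣q∣+∣r∣ fa fb Bp) (x<m∧y<m∧z≤m⇒x+y+z<3m light-a light-b small))
      where
      fa = fibre own (fsuc ja)
      fb = fibre own (fsuc jb)
      Bp = bag E (par (tree E) jb)
      B⊆ : bag E (fsuc ja) ∪ bag E (fsuc jb) ⊆ (fa ∪ fb) ∪ Bp
      B⊆ = ∪-⊆ (bag E (fsuc ja)) (bag E (fsuc jb))
        (λ v∈ → ∪-⊆ fa _ (λ v∈fa → p⊆p∪q Bp (p⊆p∪q fb v∈fa))
                         (λ {v} v∈p → q⊆p∪q (fa ∪ fb) Bp (subst (λ x → v ∈ bag E x) pa≡pb v∈p))
                         (bag⊆fibre∪parent E owns ja v∈))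
        (λ v∈ → ∪-⊆ fb Bp (λ v∈fb → p⊆p∪q Bp (q⊆p∪q fa fb v∈fb)) (q⊆p∪q (fa ∪ fb) Bp)
                         (bag⊆fibre∪parent E owns jb v∈))

    child-parent-bag<3m : ∀ {jb} → Light own (fsuc jb) → ∣ bag E (par (tree E) jb) ∣ ≤ m →
                          ∣ bag E (par (tree E) jb) ∪ bag E (fsuc jb) ∣ < 3 * m
    child-parent-bag<3m {jb} light small = ≤-<-trans
      (p⊆q⇒∣p∣≤∣q∣ {p = Bp ∪ bag E (fsuc jb)} {q = fb ∪ Bp}
        (∪-⊆ Bp (bag E (fsuc jb)) (q⊆p∪q fb Bp) (bag⊆fibre∪parent E owns jb)))
      (≤-<-trans (∣p∪q∣≤∣p∣+∣q∣ fb Bp) (x<m∧y<m∧z≤m⇒x+y+z<3m 0<m light small))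
      where
      fb = fibre own (fsuc jb)
      Bp = bag E (par (tree E) jb)

  module MergeStep {k} (E : TreeDecomposition G (suc k)) (own : Fin n → Fin (suc (suc k)))
      (jb : Fin (suc k)) (a : Fin (suc (suc k)))
      (a<b : toℕ a < toℕ (fsuc jb))
      (parent-or-sibling : a ≡ par (tree E) jb ⊎ ∃ λ ja → a ≡ fsuc ja × par (tree E) ja ≡ par (tree E) jb)
    where

    open Merge E jb a a<b parent-or-sibling public

    own′ : Fin n → Fin (suc k)
    own′ = π ∘ own

    merged-bag<3m : ∣ bag E a ∪ bag E b ∣ < 3 * m → ∣ bag merged a′ ∣ < 3 * m
    merged-bag<3m = subst (λ S → ∣ S ∣ < 3 * m) (sym bag′-a′)

    small-merged : ∀ {s} → s ≤ toℕ a → (∀ y → toℕ y < s → ∣ bag E y ∣ ≤ m) → ∀ y → toℕ y < s → ∣ bag merged y ∣ ≤ m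
    small-merged {s} s≤a small y y<s =
      subst (λ S → ∣ S ∣ ≤ m) (sym (bag′-≢ y≢a′))
        (small (punchIn b y) (subst (_< s) (sym (toℕ-punchIn-< b y y<b)) y<s))
      where
      y<a = <-≤-trans y<s s≤a
      y<b = ℕ.<-trans y<a a<b
      y≢a′ : y ≢ a′
      y≢a′ y≡a′ = ℕ.<⇒≢ y<a (trans (cong toℕ y≡a′) toℕ-a′)

    settled-unmerged : ∀ {s j′} → s ≤ toℕ b → fsuc j′ ≢ a′ →
                       Settled s E own (punchIn jb j′) → Settled s merged own′ j′
    settled-unmerged s≤b j′≢a′ (inj₁ (heavy , bag<3m)) = inj₁
      ( subst (m ≤_) (sym (∣fibre∣-≢a′ own j′≢a′)) heavy
      , subst (λ S → ∣ S ∣ < 3 * m) (sym (bag′-≢ j′≢a′)) bag<3m )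
    settled-unmerged {s} s≤b j′≢a′ (inj₂ (light , par<s)) = inj₂
      ( subst (_< m) (sym (∣fibre∣-≢a′ own j′≢a′)) light
      , subst (_< s) (sym (toℕ-π (<-≤-trans par<s s≤b))) par<s )

    settled-merged : ∀ {s} → s ≤ toℕ b → ∣ bag E a ∪ bag E b ∣ < 3 * m →
                     (∀ {ja} → a ≡ fsuc ja → toℕ (par (tree E) ja) < s) →
                     (∀ j′ → fsuc j′ ≢ a′ → s ≤ toℕ (fsuc j′) → Settled s E own (punchIn jb j′)) →
                     ∀ j′ → s ≤ toℕ (fsuc j′) → Settled s merged own′ j′
    settled-merged {s} s≤b bound par<s old j′ s≤j′ = by-cases (fsuc j′ ≟ a′)
      where
      by-cases : Dec (fsuc j′ ≡ a′) → Settled s merged own′ j′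
      by-cases (no j′≢a′)  = settled-unmerged s≤b j′≢a′ (old j′ j′≢a′ s≤j′)
      by-cases (yes j′≡a′) = let (a≡ , toℕ-par) = a′-parent j′≡a′ in
        settle {E = merged} {own′} j′ (subst (λ z → ∣ bag merged z ∣ < 3 * m) (sym j′≡a′) (merged-bag<3m bound))
                                     (subst (_< s) (sym toℕ-par) (par<s a≡))

  absorb-light-child : ∀ {k t} {E : TreeDecomposition G (suc k)} {own} → Processed (suc t) E own →
                       ∀ jb → LightChild t E own jb → (∀ j → LightChild t E own j → j ≡ jb) → ProcessedTD t
  absorb-light-child {k} {t} {E} {own} p jb (pb≡t , light) unique = k , merged , own′ , record
    { slick     = slick-merged slick
    ; ownership = ownership-merged ownership
    ; small     = small-merged (ℕ.≤-reflexive (sym pb≡t)) (λ y y<t → small y (m<n⇒m<1+n y<t))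
    ; settled   = settled-merged t≤b bound par<t old
    ; root      = λ t≡0 → subst (λ z → ∣ bag merged z ∣ < 3 * m) (a′≡0 t≡0) (merged-bag<3m bound)
    }
    where
    open Processed p
    T = tree E
    open MergeStep E own jb (par T jb) (par-lt T jb) (inj₁ refl)
    toℕ-a′≡t : toℕ a′ ≡ t
    toℕ-a′≡t = trans toℕ-a′ pb≡t
    t≤b : t ≤ toℕ b
    t≤b = <⇒≤ (subst (_< toℕ b) pb≡t (par-lt T jb))
    bound : ∣ bag E (par T jb) ∪ bag E (fsuc jb) ∣ < 3 * m
    bound = child-parent-bag<3m E ownership light (small (par T jb) (s≤s (ℕ.≤-reflexive pb≡t)))
    a′≡0 : t ≡ 0 → a′ ≡ fzero
    a′≡0 t≡0 = toℕ-injective (trans toℕ-a′≡t t≡0)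
    par<t : ∀ {ja} → par T jb ≡ fsuc ja → toℕ (par T ja) < t
    par<t {ja} a≡ = subst (toℕ (par T ja) <_) (trans (cong toℕ (sym a≡)) pb≡t) (par-lt T ja)
    old : ∀ j′ → fsuc j′ ≢ a′ → t ≤ toℕ (fsuc j′) → Settled t E own (punchIn jb j′)
    old j′ j′≢a′ t≤j′ = settled-below {E = E} {own} (settled c (≤-trans t<j′ (s≤s (toℕ≤toℕ-punchIn jb j′))))
                                                  (λ lc → punchInᵢ≢i jb j′ (unique c lc))
      where
      c = punchIn jb j′
      t<j′ : t < toℕ (fsuc j′)
      t<j′ = ℕ.≤∧≢⇒< t≤j′ (λ t≡j′ → j′≢a′ (toℕ-injective (trans (sym t≡j′) (sym toℕ-a′≡t))))

  merge-light-siblings : ∀ {k t} {E : TreeDecomposition G (suc k)} {own} → Processed (suc t) E own →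
                         ∀ {ja jb} → toℕ ja < toℕ jb → LightChild t E own ja → LightChild t E own jb →
                         Σ (TreeDecomposition G k) λ E′ → Σ (Fin n → Fin (suc k)) (Processed (suc t) E′)
  merge-light-siblings {k} {t} {E} {own} p {ja} {jb} ja<jb (pa≡t , light-a) (pb≡t , light-b) =
    merged , own′ , record
    { slick     = slick-merged slick
    ; ownership = ownership-merged ownership
    ; small     = small-merged (subst (λ x → suc x ≤ toℕ (fsuc ja)) pa≡t (par-lt T ja)) small
    ; settled   = settled-merged (subst (λ x → suc x ≤ toℕ (fsuc jb)) pb≡t (par-lt T jb)) bound par<1+t
                    (λ j′ _ le → settled (punchIn jb j′) (≤-trans le (s≤s (toℕ≤toℕ-punchIn jb j′))))
    ; root      = λ ()
    }
    where
    open Processed p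
    T = tree E
    pa≡pb : par T ja ≡ par T jb
    pa≡pb = toℕ-injective (trans pa≡t (sym pb≡t))
    open MergeStep E own jb (fsuc ja) (s≤s ja<jb) (inj₂ (ja , refl , pa≡pb))
    bound : ∣ bag E (fsuc ja) ∪ bag E (fsuc jb) ∣ < 3 * m
    bound = siblings-bag<3m E ownership pa≡pb light-a light-b (small (par T jb) (s≤s (ℕ.≤-reflexive pb≡t)))
    par<1+t : ∀ {ja′} → fsuc ja ≡ fsuc ja′ → toℕ (par T ja′) < suc t
    par<1+t refl = s≤s (ℕ.≤-reflexive pa≡t)

  merge-distinct-light-siblings : ∀ {k t} {E : TreeDecomposition G (suc k)} {own} → Processed (suc t) E own →
                                  ∀ {j₁ j₂} → j₁ ≢ j₂ → LightChild t E own j₁ → LightChild t E own j₂ →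
                                  Σ (TreeDecomposition G k) λ E′ → Σ (Fin n → Fin (suc k)) (Processed (suc t) E′)
  merge-distinct-light-siblings p {j₁} {j₂} j₁≢j₂ lc₁ lc₂ with ℕ.<-cmp (toℕ j₁) (toℕ j₂)
  ... | tri< j₁<j₂ _ _ = merge-light-siblings p j₁<j₂ lc₁ lc₂
  ... | tri≈ _ j₁≡j₂ _ = contradiction (toℕ-injective j₁≡j₂) j₁≢j₂
  ... | tri> _ _ j₂<j₁ = merge-light-siblings p j₂<j₁ lc₂ lc₁

  process-level : ∀ {k t} (E : TreeDecomposition G k) own → Processed (suc t) E own → ProcessedTD t
  process-level {zero} E own p = _ , E , own , no-light-child p (λ ())
  process-level {suc k} {t} E own p with any? (lightChild? t E own)
  ... | no none = _ , E , own , no-light-child p (λ j lc → none (j , lc))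
  ... | yes (j₁ , lc₁) with any? (λ j → ¬? (j ≟ j₁) ×-dec lightChild? t E own j)
  ...   | no only-j₁ =
          absorb-light-child p j₁ lc₁ (λ j lc → decidable-stable (j ≟ j₁) (λ j≢j₁ → only-j₁ (j , j≢j₁ , lc)))
  ...   | yes (j₂ , j₂≢j₁ , lc₂) =
          let (E′ , own′ , p′) = merge-distinct-light-siblings p j₂≢j₁ lc₂ lc₁ in process-level {k} E′ own′ p′

  process : ∀ s → ProcessedTD s → ProcessedTD 0
  process zero    P                 = P
  process (suc t) (_ , E , own , p) = process t (process-level E own p)

  initial : (D : RootedTD G) → Slick D → (∀ x → ∣ bag D x ∣ ≤ m) → ProcessedTD (suc (RootedTD.k D))
  initial D slick small = _ , E , owner , record
    { slick     = slick
    ; ownership = λ v z v∈z → Sum.map₁ (topmost-unique T (vertex-connected E v) (proj₂ (top v)))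
                                       (topmost⊎parent T (λ x → v ∈? bag E x) v∈z)
    ; small     = λ y _ → small y
    ; settled   = λ j k<j → contradiction (ℕ.≤-pred k<j) (<⇒≱ (toℕ<n j))
    ; root      = λ ()
    }
    where
    E = fromRootedTD D
    T = tree E
    top : ∀ v → ∃ (Topmost T (λ x → v ∈ bag E x))
    top v = let (x , v∈x) = proj₁ (vertex-connected E v) in topmost T (λ x → v ∈? bag E x) v∈x
    owner : Fin n → Fin (suc (RootedTD.k D))
    owner v = proj₁ (top v)

  record Coarse {k} (E : TreeDecomposition G k) (own : Fin n → Fin (suc k)) : Set where
    field
      slick  : Slick (toRootedTD E)
      heavy  : ∀ z → m ≤ ∣ fibre own z ∣
      narrow : ∀ z → 2 + ∣ bag E z ∣ ≤ 4 * m

  CoarseTD : Set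
  CoarseTD = Σ ℕ λ k → Σ (TreeDecomposition G k) λ E → Σ (Fin n → Fin (suc k)) (Coarse E)

  <3m⇒narrow : ∀ {x} → x < 3 * m → 2 + x ≤ 4 * m
  <3m⇒narrow = x<m∧y<3m⇒2+x+y≤4m 0<m

  all-finished : ∀ {k} {E : TreeDecomposition G k} {own} → Processed 0 E own → ∀ j → Finished E own (fsuc j)
  all-finished p j with Processed.settled p j z≤n
  ... | inj₁ finished = finished

  coarse-if-heavy-root : ∀ {k} {E : TreeDecomposition G k} {own} →
                         Processed 0 E own → m ≤ ∣ fibre own fzero ∣ → Coarse E own
  coarse-if-heavy-root p heavy-root = record
    { slick  = Processed.slick p
    ; heavy  = λ { fzero → heavy-root ; (fsuc j) → proj₁ (all-finished p j) }
    ; narrow = λ { fzero → <3m⇒narrow (Processed.root p refl) ; (fsuc j) → <3m⇒narrow (proj₂ (all-finished p j)) }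
    }

  merge-into-light-root : ∀ {k} (E : TreeDecomposition G (suc k)) own →
                          Processed 0 E own → Light own fzero → CoarseTD
  merge-into-light-root {k} E own p light-root = k , merged , own′ , record
    { slick  = slick-merged (Processed.slick p)
    ; heavy  = heavy
    ; narrow = narrow
    }
    where
    T = tree E
    open MergeStep E own fzero (par T fzero) (par-lt T fzero) (inj₁ refl)
    a≡0 : par T fzero ≡ fzero
    a≡0 = toℕ-injective (ℕ.n<1⇒n≡0 (par-lt T fzero))
    a′≡0 : a′ ≡ fzero
    a′≡0 = toℕ-injective (trans toℕ-a′ (cong toℕ a≡0))
    fsuc≢a′ : ∀ j′ → fsuc j′ ≢ a′
    fsuc≢a′ j′ eq with trans eq a′≡0
    ... | ()
    heavy : ∀ z → m ≤ ∣ fibre own′ z ∣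
    heavy fzero = subst (λ z → m ≤ ∣ fibre own′ z ∣) a′≡0
      (≤-trans (proj₁ (all-finished p fzero)) (∣fibre-b∣≤∣fibre-a′∣ own))
    heavy (fsuc j′) = subst (m ≤_) (sym (∣fibre∣-≢a′ own (fsuc≢a′ j′))) (proj₁ (all-finished p (punchIn fzero j′)))
    root-bag<m : ∣ bag E (par T fzero) ∣ < m
    root-bag<m = ≤-<-trans
      (p⊆q⇒∣p∣≤∣q∣ (subst (λ x → bag E x ⊆ fibre own fzero) (sym a≡0) (root-bag⊆fibre E (Processed.ownership p))))
      light-root
    narrow : ∀ z → 2 + ∣ bag merged z ∣ ≤ 4 * m
    narrow fzero = subst (λ z → 2 + ∣ bag merged z ∣ ≤ 4 * m) a′≡0 (subst (λ S → 2 + ∣ S ∣ ≤ 4 * m) (sym bag′-a′)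
      (≤-trans (s≤s (s≤s (∣p∪q∣≤∣p∣+∣q∣ (bag E (par T fzero)) (bag E b))))
               (x<m∧y<3m⇒2+x+y≤4m root-bag<m (proj₂ (all-finished p fzero)))))
    narrow (fsuc j′) = subst (λ S → 2 + ∣ S ∣ ≤ 4 * m) (sym (bag′-≢ (fsuc≢a′ j′)))
      (<3m⇒narrow (proj₂ (all-finished p (punchIn fzero j′))))

  finish : m ≤ n → ∀ {k} (E : TreeDecomposition G k) own → Processed 0 E own → CoarseTD
  finish m≤n E own p with m ≤? ∣ fibre own fzero ∣
  ... | yes heavy-root = _ , E , own , coarse-if-heavy-root p heavy-root
  finish m≤n {suc k} E own p | no light-root = merge-into-light-root E own p (≰⇒> light-root)
  finish m≤n {zero}  E own p | no light-root = contradiction (≤-trans m≤n n≤∣fibre∣) light-root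
    where
    n≤∣fibre∣ : n ≤ ∣ fibre own fzero ∣
    n≤∣fibre∣ = subst (_≤ ∣ fibre own fzero ∣) (∣⊤∣≡n n)
      (p⊆q⇒∣p∣≤∣q∣ {p = ⊤} (λ {v} _ → ∈-fibre⁺ own (only-node (own v))))
      where
      only-node : (x : Fin 1) → x ≡ fzero
      only-node fzero = refl

  coarsen : m ≤ n → (D : RootedTD G) → Slick D → (∀ x → ∣ bag D x ∣ ≤ m) →
            Σ (RootedTD G) λ D′ → Slick D′ × (∀ x → 2 + ∣ bag D′ x ∣ ≤ 4 * m) × order D′ * m ≤ n
  coarsen m≤n D slick small =
    let (_ , E , own , p)     = process _ (initial D slick small)
        (_ , E′ , own′ , c)   = finish m≤n E own p
    in toRootedTD E′ , Coarse.slick c , Coarse.narrow c , large-fibres⇒K*m≤n own′ (Coarse.heavy c)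

ℓ∸1≤2ℓ∸2 : ∀ ℓ → ℓ ∸ 1 ≤ 2 * ℓ ∸ 2
ℓ∸1≤2ℓ∸2 ℓ = subst (ℓ ∸ 1 ≤_) (ℕ.*-distribˡ-∸ 2 ℓ 1) (ℕ.m≤m+n (ℓ ∸ 1) _)

2+x≤4[ℓ∸1]⇒x≤1+[4ℓ∸7] : ∀ ℓ {x} → 2 ≤ ℓ → 2 + x ≤ 4 * (ℓ ∸ 1) → x ≤ suc (4 * ℓ ∸ 7)
2+x≤4[ℓ∸1]⇒x≤1+[4ℓ∸7] (suc (suc m₀)) {x} (s≤s (s≤s z≤n)) 2+x≤4m = begin
  x                           ≤⟨ ℕ.≤-pred (ℕ.≤-pred (subst (2 + x ≤_) (4[1+m₀] m₀) 2+x≤4m)) ⟩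
  2 + 4 * m₀                  ≡⟨ cong suc (sym (ℕ.m+n∸m≡n 7 (suc (4 * m₀)))) ⟩
  suc (7 + suc (4 * m₀) ∸ 7)  ≡⟨ cong (λ y → suc (y ∸ 7)) (sym (4[2+m₀] m₀)) ⟩
  suc (4 * suc (suc m₀) ∸ 7)  ∎
  where
  open ≤-Reasoning
  4[1+m₀] : ∀ m₀ → 4 * suc m₀ ≡ 2 + (2 + 4 * m₀)
  4[1+m₀] = solve-∀
  4[2+m₀] : ∀ m₀ → 4 * suc (suc m₀) ≡ 7 + suc (4 * m₀)
  4[2+m₀] = solve-∀

lemma27 : (ℓ : ℕ) → 2 ≤ ℓ → (n : ℕ) → (G : Graph n) → 2 * ℓ ∸ 2 ≤ n →
    Σ (RootedTD G) (λ D → Slick D × WidthAtMost D (ℓ ∸ 2)) →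
    Σ (RootedTD G) (λ D → Slick D × WidthAtMost D (4 * ℓ ∸ 7) × (order D * (ℓ ∸ 1) ≤ n))
lemma27 ℓ@(suc (suc m₀)) 2≤ℓ n G 2ℓ∸2≤n (D , slick , width) =
  let (D′ , slick′ , narrow , order≤) = coarsen (≤-trans (ℓ∸1≤2ℓ∸2 ℓ) 2ℓ∸2≤n) D slick width
  in D′ , slick′ , (λ x → 2+x≤4[ℓ∸1]⇒x≤1+[4ℓ∸7] ℓ 2≤ℓ (narrow x)) , order≤
  where open Coarsening {G = G} (suc m₀) (s≤s z≤n)
lemma27 (suc zero) (s≤s ())
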